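{- Let $U\cong\Lambda$, $\Upsilon=\frac1{\sqrt2}U$, and let $M,N$ be a polarization of $\Upsilon$ with $M\cong N\cong\Lambda$. Let $(w,x,y,z)$ be an offender and let $K$ be the $\mathbb Z$-span of $w,x,y,z$. Then (i) the image of $K$ in $(M+N)/M$ has order 2; (ii) $K$ is an even integral lattice.
   Context: All lattices are positive definite rational lattices. The Leech lattice $\Lambda$ is the (unique up to isometry) even unimodular lattice of rank 24 with no vectors of norm 2. For $U$ even unimodular and $\Upsilon=\frac1{\sqrt2}U$, a polarization of $\Upsilon$ is a pair of integral sublattices $M,N\subseteq\Upsilon$ with $M+N=\Upsilon$ and $M\cap N=2\Upsilon$. An ordered 4-tuple $(w,x,y,z)\in N\times M\times M\times M$ is admissible if $x+y+z\in M\cap N$. An offender is an admissible 4-tuple $(w,x,y,z)$ such that each of $x+w$, $y+w$, $z+w$ has norm 2. -}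

module Defs where

open import Data.Nat using (ℕ; zero; suc)
open import Data.Fin using (Fin)
open import Data.Integer using (ℤ; +_; _+_; _*_; -_; _-_; _<_)
open import Data.Integer.Divisibility.Signed using (_∣_)
open import Data.Product using (Σ; ∃; _×_; _,_)
open import Data.Sum using (_⊎_)
open import Relation.Binary.PropositionalEquality using (_≡_; _≢_)
open import Relation.Nullary using (¬_)

Vec : ℕ → Set
Vec n = Fin n → ℤ

Mat : ℕ → Set
Mat n = Fin n → Fin n → ℤ

sumFin : ∀ {n} → (Fin n → ℤ) → ℤ
sumFin {zero}  f = + 0
sumFin {suc n} f = f Fin.zero + sumFin (λ i → f (Fin.suc i))

_⊕_ : ∀ {n} → Vec n → Vec n → Vec n
(u ⊕ v) i = u i + v i

_⊖_ : ∀ {n} → Vec n → Vec n → Vec n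
(u ⊖ v) i = u i - v i

_·_ : ∀ {n} → ℤ → Vec n → Vec n
(a · v) i = a * v i

infixl 6 _⊕_ _⊖_
infixl 7 _·_

_≈_ : ∀ {n} → Vec n → Vec n → Set
u ≈ v = ∀ i → u i ≡ v i

_≈M_ : ∀ {n} → Mat n → Mat n → Set
A ≈M B = ∀ i j → A i j ≡ B i j

zeroV : ∀ {n} → Vec n
zeroV i = + 0

_⋆_ : ∀ {n} → Mat n → Vec n → Vec n
(A ⋆ v) i = sumFin (λ j → A i j * v j)

_⊗_ : ∀ {n} → Mat n → Mat n → Mat n
(A ⊗ B) i j = sumFin (λ k → A i k * B k j)

transpose : ∀ {n} → Mat n → Mat n
transpose A i j = A j i

idM : ∀ {n} → Mat n
idM i j with i Data.Fin.≟ j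
... | Relation.Nullary.yes _ = + 1
... | Relation.Nullary.no  _ = + 0

form : ∀ {n} → Mat n → Vec n → Vec n → ℤ
form A u v = sumFin (λ i → u i * (A ⋆ v) i)

-- Lattices given by a Gram matrix A with respect to a Z-basis.
-- "A is the Gram matrix of a lattice isometric to the Leech lattice":
-- positive definite, symmetric, even, unimodular (A invertible over ℤ,
-- i.e. det A = ±1), no vectors of norm 2, rank 24.
record IsLeechGram (A : Mat 24) : Set where
  field
    symmetric   : ∀ i j → A i j ≡ A j i
    posdef      : ∀ (c : Vec 24) → ¬ (c ≈ zeroV) → + 0 < form A c c
    even        : ∀ i → + 2 ∣ A i i
    unimodular  : Σ (Mat 24) λ H → (A ⊗ H) ≈M idM
    noRoots     : ∀ (c : Vec 24) → form A c c ≢ + 2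

-- U ≅ Λ is modelled as ℤ^24 with Gram matrix G satisfying
-- IsLeechGram G.  Υ = (1/√2) U has the same underlying group ℤ^24 and
-- inner product ⟨u,v⟩_Υ = (form G u v) / 2.  To stay inside ℤ we work
-- with  dbl u v := form G u v = 2⟨u,v⟩_Υ.

InSpan : Mat 24 → Vec 24 → Set
InSpan B v = Σ (Vec 24) λ c → v ≈ (B ⋆ c)

-- Sublattice of Υ spanned by the columns of B is isometric to Λ
-- (w.r.t. the Υ inner product): its Gram matrix Bᵀ G B / 2 is a
-- Leech Gram matrix.
SubIsLeech : Mat 24 → Mat 24 → Set
SubIsLeech G B = Σ (Mat 24) λ A →
  (∀ i j → (transpose B ⊗ (G ⊗ B)) i j ≡ + 2 * A i j) × IsLeechGram A

-- integral sublattice of Υ : ⟨u,v⟩_Υ ∈ ℤ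
IntegralSub : Mat 24 → Mat 24 → Set
IntegralSub G B = ∀ u v → InSpan B u → InSpan B v → + 2 ∣ form G u v

record IsPolarization (G BM BN : Mat 24) : Set where
  field
    M-integral : IntegralSub G BM
    N-integral : IntegralSub G BN
    sum-all    : ∀ (v : Vec 24) → Σ (Vec 24) λ m → Σ (Vec 24) λ n →
                   InSpan BM m × InSpan BN n × v ≈ (m ⊕ n)
    cap-to-2Υ  : ∀ (v : Vec 24) → InSpan BM v → InSpan BN v →
                   Σ (Vec 24) λ u → v ≈ (+ 2 · u)
    2Υ-to-cap  : ∀ (u : Vec 24) → InSpan BM (+ 2 · u) × InSpan BN (+ 2 · u)

-- Υ-norm of v equals 2  ⇔  form G v v = 4
NormΥ≡2 : Mat 24 → Vec 24 → Set
NormΥ≡2 G v = form G v v ≡ + 4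

record Admissible (BM BN : Mat 24) (w x y z : Vec 24) : Set where
  field
    w∈N   : InSpan BN w
    x∈M   : InSpan BM x
    y∈M   : InSpan BM y
    z∈M   : InSpan BM z
    s∈M   : InSpan BM (x ⊕ y ⊕ z)
    s∈N   : InSpan BN (x ⊕ y ⊕ z)

record Offender (G BM BN : Mat 24) (w x y z : Vec 24) : Set where
  field
    admissible : Admissible BM BN w x y z
    xw         : NormΥ≡2 G (x ⊕ w)
    yw         : NormΥ≡2 G (y ⊕ w)
    zw         : NormΥ≡2 G (z ⊕ w)

InK : (w x y z : Vec 24) → Vec 24 → Set
InK w x y z v = Σ ℤ λ a → Σ ℤ λ b → Σ ℤ λ c → Σ ℤ λ d →
  v ≈ (a · w ⊕ b · x ⊕ c · y ⊕ d · z)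

-- (i) the image of K in (M+N)/M = Υ/M has exactly two elements:
-- there is k₀ ∈ K with k₀ ∉ M (so 0+M ≠ k₀+M), and every k ∈ K
-- satisfies k + M = M or k + M = k₀ + M.
ImageOrder2 : Mat 24 → (Vec 24 → Set) → Set
ImageOrder2 BM K = Σ (Vec 24) λ k₀ → K k₀ × ¬ InSpan BM k₀ ×
  (∀ k → K k → InSpan BM k ⊎ InSpan BM (k ⊖ k₀))

-- (ii) K is an even integral lattice w.r.t. the Υ inner product:
-- ⟨k,k'⟩_Υ ∈ ℤ and ⟨k,k⟩_Υ ∈ 2ℤ.
EvenIntegral : Mat 24 → (Vec 24 → Set) → Set
EvenIntegral G K =
  (∀ k k' → K k → K k' → + 2 ∣ form G k k') ×
  (∀ k → K k → + 4 ∣ form G k k)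

-- Write ⟨·,·⟩ for the inner product of Υ; the integer form G computes 2⟨·,·⟩.
-- Vectors of M and N have even norm, so from ⟨x+w,x+w⟩ = 2 the polarization
-- identity gives ⟨x,w⟩ ∈ ℤ, and likewise for y and z.  Together with the
-- integrality of M and N this makes all inner products of the generators
-- integral and all their norms even, and both properties pass to the span K.
-- For (i): 2w ∈ 2Υ ⊆ M while w ∉ M (otherwise x+w would be a root of M ≅ Λ),
-- and x, y, z ∈ M, so k = aw + bx + cy + dz lies in M or in w + M according
-- to the parity of a.
module Submission where

open import Defs
open import Data.Nat as ℕ using (s≤s)
open import Data.Fin using (Fin; zero; suc)
open import Data.Integer using (ℤ; +_; _+_; _*_; _-_)
open import Data.Integer.Properties as ℤP using ()
open import Data.Integer.Divisibility.Signed
  using (_∣_; divides; ∣-reflexive; ∣m∣n⇒∣m+n; ∣m+n∣m⇒∣n; ∣m+n∣n⇒∣m; ∣n⇒∣m*n; ∣m⇒∣m*n;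
         *-monoʳ-∣; *-cancelˡ-∣)
open import Data.Integer.DivMod using (_%ℕ_; _/ℕ_; a≡a%ℕn+[a/ℕn]*n; n%ℕd<d)
open import Data.Integer.Tactic.RingSolver using (solve-∀)
open import Algebra.Properties.Semiring.Sum ℤP.+-*-semiring
  using (sum; sum-cong-≗; ∑-distrib-+; ∑-comm; *-distribˡ-sum; *-distribʳ-sum)
open import Algebra.Properties.CommutativeSemigroup ℤP.*-commutativeSemigroup
  using (x∙yz≈y∙xz; x∙yz≈z∙yx)
open import Data.Product using (Σ; _×_; _,_; proj₁; proj₂)
open import Data.Sum using (_⊎_; inj₁; inj₂)
open import Function using (_∘_)
open import Relation.Binary.PropositionalEquality
open import Relation.Nullary using (¬_)

sumFin≡sum : ∀ {n} (f : Fin n → ℤ) → sumFin f ≡ sum f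
sumFin≡sum {ℕ.zero}  f = refl
sumFin≡sum {ℕ.suc n} f = cong (_+_ (f zero)) (sumFin≡sum (f ∘ suc))

sumFin-cong : ∀ {n} {f g : Fin n → ℤ} → f ≗ g → sumFin f ≡ sumFin g
sumFin-cong {f = f} {g} f≗g =
  trans (sumFin≡sum f) (trans (sum-cong-≗ f≗g) (sym (sumFin≡sum g)))

sumFin-distrib-+ : ∀ {n} (f g : Fin n → ℤ) →
  sumFin (λ i → f i + g i) ≡ sumFin f + sumFin g
sumFin-distrib-+ f g = trans (sumFin≡sum (λ i → f i + g i))
  (trans (∑-distrib-+ f g) (sym (cong₂ _+_ (sumFin≡sum f) (sumFin≡sum g))))

*-distribˡ-sumFin : ∀ {n} a (f : Fin n → ℤ) → a * sumFin f ≡ sumFin (λ i → a * f i)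
*-distribˡ-sumFin a f =
  trans (cong (a *_) (sumFin≡sum f)) (trans (*-distribˡ-sum a f) (sym (sumFin≡sum (λ i → a * f i))))

*-distribʳ-sumFin : ∀ {n} a (f : Fin n → ℤ) → sumFin f * a ≡ sumFin (λ i → f i * a)
*-distribʳ-sumFin a f =
  trans (cong (_* a) (sumFin≡sum f)) (trans (*-distribʳ-sum a f) (sym (sumFin≡sum (λ i → f i * a))))

sumFin-comm : ∀ {m n} (f : Fin m → Fin n → ℤ) →
  sumFin (λ i → sumFin (f i)) ≡ sumFin (λ j → sumFin (λ i → f i j))
sumFin-comm f = trans (sumFin²≡sum² f) (trans (∑-comm f) (sym (sumFin²≡sum² (λ j i → f i j))))
  where
  sumFin²≡sum² : ∀ {m n} (g : Fin m → Fin n → ℤ) →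
    sumFin (λ i → sumFin (g i)) ≡ sum (λ i → sum (g i))
  sumFin²≡sum² g = trans (sumFin≡sum (λ i → sumFin (g i))) (sum-cong-≗ (λ i → sumFin≡sum (g i)))

symmetric-double-sum-even : ∀ {n} (f : Fin n → Fin n → ℤ) →
  (∀ i j → f i j ≡ f j i) → (∀ i → + 2 ∣ f i i) → + 2 ∣ sumFin (λ i → sumFin (f i))
symmetric-double-sum-even {ℕ.zero}  f f-sym f-diag = divides (+ 0) refl
symmetric-double-sum-even {ℕ.suc n} f f-sym f-diag =
  subst (+ 2 ∣_) (sym split)
    (∣m∣n⇒∣m+n (∣m∣n⇒∣m+n (f-diag zero) (∣m⇒∣m*n r (∣-reflexive refl)))
               (symmetric-double-sum-even f′ (λ i j → f-sym (suc i) (suc j)) (f-diag ∘ suc)))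
  where
  open ≡-Reasoning
  f′ : Fin n → Fin n → ℤ
  f′ i j = f (suc i) (suc j)
  r t : ℤ
  r = sumFin (λ j → f zero (suc j))
  t = sumFin (λ i → sumFin (f′ i))
  regroup : ∀ a r t → (a + r) + (r + t) ≡ a + + 2 * r + t
  regroup = solve-∀
  split : sumFin (λ i → sumFin (f i)) ≡ f zero zero + + 2 * r + t
  split = begin
    (f zero zero + r) + sumFin (λ i → f (suc i) zero + sumFin (f′ i))
      ≡⟨ cong (_+_ (f zero zero + r)) (sumFin-distrib-+ (λ i → f (suc i) zero) (λ i → sumFin (f′ i))) ⟩
    (f zero zero + r) + (sumFin (λ i → f (suc i) zero) + t)
      ≡⟨ cong (λ s → f zero zero + r + (s + t)) (sumFin-cong (λ i → f-sym (suc i) zero)) ⟩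
    (f zero zero + r) + (r + t)
      ≡⟨ regroup (f zero zero) r t ⟩
    f zero zero + + 2 * r + t ∎

dot : ∀ {n} → Vec n → Vec n → ℤ
dot u v = sumFin (λ i → u i * v i)

dot-comm : ∀ {n} (u v : Vec n) → dot u v ≡ dot v u
dot-comm u v = sumFin-cong (λ i → ℤP.*-comm (u i) (v i))

dot-cong : ∀ {n} {u u′ v v′ : Vec n} → u ≈ u′ → v ≈ v′ → dot u v ≡ dot u′ v′
dot-cong u≈u′ v≈v′ = sumFin-cong (λ i → cong₂ _*_ (u≈u′ i) (v≈v′ i))

dot-⊕ʳ : ∀ {n} (u v v′ : Vec n) → dot u (v ⊕ v′) ≡ dot u v + dot u v′
dot-⊕ʳ u v v′ = trans (sumFin-cong (λ i → ℤP.*-distribˡ-+ (u i) (v i) (v′ i)))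
                      (sumFin-distrib-+ (λ i → u i * v i) (λ i → u i * v′ i))

dot-·ʳ : ∀ {n} (u : Vec n) a (v : Vec n) → dot u (a · v) ≡ a * dot u v
dot-·ʳ u a v = trans (sumFin-cong (λ i → x∙yz≈y∙xz (u i) a (v i)))
                     (sym (*-distribˡ-sumFin a (λ i → u i * v i)))

dot-⊕ˡ : ∀ {n} (u u′ v : Vec n) → dot (u ⊕ u′) v ≡ dot u v + dot u′ v
dot-⊕ˡ u u′ v = trans (dot-comm (u ⊕ u′) v)
  (trans (dot-⊕ʳ v u u′) (cong₂ _+_ (dot-comm v u) (dot-comm v u′)))

dot-·ˡ : ∀ {n} a (u v : Vec n) → dot (a · u) v ≡ a * dot u v
dot-·ˡ a u v = trans (dot-comm (a · u) v) (trans (dot-·ʳ v a u) (cong (a *_) (dot-comm v u)))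

-- (A ⋆ v) i is definitionally dot (A i) v, so linearity of ⋆ is that of dot.
⋆-cong : ∀ {n} (A : Mat n) {v v′ : Vec n} → v ≈ v′ → (A ⋆ v) ≈ (A ⋆ v′)
⋆-cong A v≈v′ i = dot-cong {u = A i} (λ _ → refl) v≈v′

⋆-⊕ : ∀ {n} (A : Mat n) (u v : Vec n) → (A ⋆ (u ⊕ v)) ≈ ((A ⋆ u) ⊕ (A ⋆ v))
⋆-⊕ A u v i = dot-⊕ʳ (A i) u v

⋆-· : ∀ {n} (A : Mat n) a (v : Vec n) → (A ⋆ (a · v)) ≈ (a · (A ⋆ v))
⋆-· A a v i = dot-·ʳ (A i) a v

⋆-⊗ : ∀ {n} (A B : Mat n) (c : Vec n) → (A ⋆ (B ⋆ c)) ≈ ((A ⊗ B) ⋆ c)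
⋆-⊗ A B c i = begin
  sumFin (λ j → A i j * sumFin (λ k → B j k * c k))
    ≡⟨ sumFin-cong (λ j → *-distribˡ-sumFin (A i j) (λ k → B j k * c k)) ⟩
  sumFin (λ j → sumFin (λ k → A i j * (B j k * c k)))
    ≡⟨ sumFin-comm (λ j k → A i j * (B j k * c k)) ⟩
  sumFin (λ k → sumFin (λ j → A i j * (B j k * c k)))
    ≡⟨ sumFin-cong (λ k → sumFin-cong (λ j → sym (ℤP.*-assoc (A i j) (B j k) (c k)))) ⟩
  sumFin (λ k → sumFin (λ j → A i j * B j k * c k))
    ≡⟨ sumFin-cong (λ k → sym (*-distribʳ-sumFin (c k) (λ j → A i j * B j k))) ⟩
  sumFin (λ k → (A ⊗ B) i k * c k) ∎
  where open ≡-Reasoning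

dot-⋆ : ∀ {n} (B : Mat n) (c v : Vec n) → dot (B ⋆ c) v ≡ dot c (transpose B ⋆ v)
dot-⋆ B c v = begin
  sumFin (λ i → sumFin (λ k → B i k * c k) * v i)
    ≡⟨ sumFin-cong (λ i → *-distribʳ-sumFin (v i) (λ k → B i k * c k)) ⟩
  sumFin (λ i → sumFin (λ k → B i k * c k * v i))
    ≡⟨ sumFin-comm (λ i k → B i k * c k * v i) ⟩
  sumFin (λ k → sumFin (λ i → B i k * c k * v i))
    ≡⟨ sumFin-cong (λ k → sumFin-cong (λ i → rearrange (B i k) (c k) (v i))) ⟩
  sumFin (λ k → sumFin (λ i → c k * (B i k * v i)))
    ≡⟨ sumFin-cong (λ k → sym (*-distribˡ-sumFin (c k) (λ i → B i k * v i))) ⟩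
  sumFin (λ k → c k * (transpose B ⋆ v) k) ∎
  where
  open ≡-Reasoning
  rearrange : ∀ b c v → b * c * v ≡ c * (b * v)
  rearrange = solve-∀

IsSymmetric : ∀ {n} → Mat n → Set
IsSymmetric A = ∀ i j → A i j ≡ A j i

form-cong : ∀ {n} (A : Mat n) {u u′ v v′ : Vec n} → u ≈ u′ → v ≈ v′ →
  form A u v ≡ form A u′ v′
form-cong A u≈u′ v≈v′ = dot-cong u≈u′ (⋆-cong A v≈v′)

form-⊕ʳ : ∀ {n} (A : Mat n) (u v v′ : Vec n) →
  form A u (v ⊕ v′) ≡ form A u v + form A u v′
form-⊕ʳ A u v v′ = trans (dot-cong {u = u} (λ _ → refl) (⋆-⊕ A v v′)) (dot-⊕ʳ u _ _)

form-·ʳ : ∀ {n} (A : Mat n) (u : Vec n) a (v : Vec n) → form A u (a · v) ≡ a * form A u v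
form-·ʳ A u a v = trans (dot-cong {u = u} (λ _ → refl) (⋆-· A a v)) (dot-·ʳ u a _)

form-sym : ∀ {n} {A : Mat n} → IsSymmetric A → ∀ u v → form A u v ≡ form A v u
form-sym {A = A} A-sym u v = begin
  dot u (A ⋆ v)              ≡⟨ dot-⋆ (transpose A) u v ⟨
  dot (transpose A ⋆ u) v    ≡⟨ dot-cong (λ i → sumFin-cong (λ j → cong (_* u j) (A-sym j i)))
                                         (λ _ → refl) ⟩
  dot (A ⋆ u) v              ≡⟨ dot-comm (A ⋆ u) v ⟩
  dot v (A ⋆ u)              ∎
  where open ≡-Reasoning

form-⋆ : ∀ {n} (G B : Mat n) (c d : Vec n) →
  form G (B ⋆ c) (B ⋆ d) ≡ form (transpose B ⊗ (G ⊗ B)) c d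
form-⋆ G B c d = trans (dot-⋆ B c (G ⋆ (B ⋆ d))) (dot-cong {u = c} (λ _ → refl) (λ i →
  trans (⋆-cong (transpose B) (⋆-⊗ G B d) i) (⋆-⊗ (transpose B) (G ⊗ B) d i)))

form-scale : ∀ {n} {C A : Mat n} a → (∀ i j → C i j ≡ a * A i j) →
  ∀ c d → form C c d ≡ a * form A c d
form-scale {C = C} {A} a C≡aA c d =
  trans (dot-cong {u = c} (λ _ → refl) C⋆d≈a·A⋆d) (dot-·ʳ c a (A ⋆ d))
  where
  C⋆d≈a·A⋆d : (C ⋆ d) ≈ (a · (A ⋆ d))
  C⋆d≈a·A⋆d i = trans (sumFin-cong (λ j → trans (cong (_* d j) (C≡aA i j))
                                               (ℤP.*-assoc a (A i j) (d j))))
                     (sym (*-distribˡ-sumFin a (λ j → A i j * d j)))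

form-norm-⊕ : ∀ {n} {A : Mat n} → IsSymmetric A → ∀ u v →
  form A (u ⊕ v) (u ⊕ v) ≡ form A u u + + 2 * form A u v + form A v v
form-norm-⊕ {A = A} A-sym u v = begin
  form A (u ⊕ v) (u ⊕ v)
    ≡⟨ dot-⊕ˡ u v _ ⟩
  form A u (u ⊕ v) + form A v (u ⊕ v)
    ≡⟨ cong₂ _+_ (form-⊕ʳ A u u v) (form-⊕ʳ A v u v) ⟩
  (form A u u + form A u v) + (form A v u + form A v v)
    ≡⟨ cong (λ b → form A u u + form A u v + (b + form A v v)) (form-sym A-sym v u) ⟩
  (form A u u + form A u v) + (form A u v + form A v v)
    ≡⟨ regroup (form A u u) (form A u v) (form A v v) ⟩
  form A u u + + 2 * form A u v + form A v v ∎
  where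
  open ≡-Reasoning
  regroup : ∀ p q r → (p + q) + (q + r) ≡ p + + 2 * q + r
  regroup = solve-∀

form-norm-· : ∀ {n} (A : Mat n) a (u : Vec n) →
  form A (a · u) (a · u) ≡ a * (a * form A u u)
form-norm-· A a u = trans (dot-·ˡ a u _) (cong (a *_) (form-·ʳ A u a u))

form-even : ∀ {n} {A : Mat n} → IsSymmetric A → (∀ i → + 2 ∣ A i i) →
  ∀ c → + 2 ∣ form A c c
form-even {n} {A} A-sym A-diag c =
  subst (+ 2 ∣_) (sym (sumFin-cong (λ i → *-distribˡ-sumFin (c i) (λ j → A i j * c j))))
    (symmetric-double-sum-even f f-sym (λ i → ∣n⇒∣m*n (c i) (∣m⇒∣m*n (c i) (A-diag i))))
  where
  f : Fin n → Fin n → ℤ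
  f i j = c i * (A i j * c j)
  f-sym : ∀ i j → f i j ≡ f j i
  f-sym i j = trans (cong (λ a → c i * (a * c j)) (A-sym i j)) (x∙yz≈z∙yx (c i) (A j i) (c j))

-- In terms of Υ these say ⟨u,v⟩ ∈ ℤ and ⟨v,v⟩ ∈ 2ℤ.
Integral : ∀ {n} → Mat n → Vec n → Vec n → Set
Integral A u v = + 2 ∣ form A u v

EvenNorm : ∀ {n} → Mat n → Vec n → Set
EvenNorm A v = + 4 ∣ form A v v

Integral-sym : ∀ {n} {A : Mat n} → IsSymmetric A → ∀ u v → Integral A u v → Integral A v u
Integral-sym A-sym u v = subst (+ 2 ∣_) (form-sym A-sym u v)

even-norms⇒integral : ∀ {n} {A : Mat n} → IsSymmetric A → ∀ u v →
  EvenNorm A u → EvenNorm A v → EvenNorm A (u ⊕ v) → Integral A u v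
even-norms⇒integral A-sym u v 4∣u 4∣v 4∣u+v =
  *-cancelˡ-∣ (+ 2) {+ 2}
    (∣m+n∣m⇒∣n (∣m+n∣n⇒∣m (subst (+ 4 ∣_) (form-norm-⊕ A-sym u v) 4∣u+v) 4∣v) 4∣u)

EvenNorm-⊕ : ∀ {n} {A : Mat n} → IsSymmetric A → ∀ u v →
  EvenNorm A u → EvenNorm A v → Integral A u v → EvenNorm A (u ⊕ v)
EvenNorm-⊕ A-sym u v 4∣u 4∣v 2∣uv = subst (+ 4 ∣_) (sym (form-norm-⊕ A-sym u v))
  (∣m∣n⇒∣m+n (∣m∣n⇒∣m+n 4∣u (*-monoʳ-∣ (+ 2) 2∣uv)) 4∣v)

EvenNorm-· : ∀ {n} (A : Mat n) a u → EvenNorm A u → EvenNorm A (a · u)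
EvenNorm-· A a u 4∣u = subst (+ 4 ∣_) (sym (form-norm-· A a u)) (∣n⇒∣m*n a (∣n⇒∣m*n a 4∣u))

record LinearlyClosed {n} (P : Vec n → Set) : Set where
  field
    ≈-closed : ∀ {u v} → u ≈ v → P u → P v
    ⊕-closed : ∀ {u v} → P u → P v → P (u ⊕ v)
    ·-closed : ∀ a {u} → P u → P (a · u)

Π-linearlyClosed : ∀ {n} {I : Set} {P : I → Vec n → Set} →
  (∀ i → LinearlyClosed (P i)) → LinearlyClosed (λ v → ∀ i → P i v)
Π-linearlyClosed P-closed = record
  { ≈-closed = λ u≈v p i → LinearlyClosed.≈-closed (P-closed i) u≈v (p i)
  ; ⊕-closed = λ p q i → LinearlyClosed.⊕-closed (P-closed i) (p i) (q i)
  ; ·-closed = λ a p i → LinearlyClosed.·-closed (P-closed i) a (p i)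
  }

Integral-linearlyClosed : ∀ {n} (A : Mat n) u → LinearlyClosed (Integral A u)
Integral-linearlyClosed A u = record
  { ≈-closed = λ v≈v′ → subst (+ 2 ∣_) (form-cong A {u} (λ _ → refl) v≈v′)
  ; ⊕-closed = λ {v} {v′} p q → subst (+ 2 ∣_) (sym (form-⊕ʳ A u v v′)) (∣m∣n⇒∣m+n p q)
  ; ·-closed = λ a {v} p → subst (+ 2 ∣_) (sym (form-·ʳ A u a v)) (∣n⇒∣m*n a p)
  }

EvenNorm-linearlyClosed : ∀ {n} {A : Mat n} {L : Vec n → Set} → IsSymmetric A →
  LinearlyClosed L → (∀ {u v} → L u → L v → Integral A u v) →
  LinearlyClosed (λ v → L v × EvenNorm A v)
EvenNorm-linearlyClosed {A = A} A-sym L-closed L-integral = record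
  { ≈-closed = λ u≈v (l , e) → ≈-closed u≈v l , subst (+ 4 ∣_) (form-cong A u≈v u≈v) e
  ; ⊕-closed = λ {u} {v} (l , e) (l′ , e′) →
      ⊕-closed l l′ , EvenNorm-⊕ A-sym u v e e′ (L-integral l l′)
  ; ·-closed = λ a {u} (l , e) → ·-closed a l , EvenNorm-· A a u e
  }
  where open LinearlyClosed L-closed

InSpan-linearlyClosed : ∀ (B : Mat 24) → LinearlyClosed (InSpan B)
InSpan-linearlyClosed B = record
  { ≈-closed = λ u≈v (c , e) → c , λ i → trans (sym (u≈v i)) (e i)
  ; ⊕-closed = λ (c , e) (d , f) → c ⊕ d , λ i →
      trans (cong₂ _+_ (e i) (f i)) (sym (⋆-⊕ B c d i))
  ; ·-closed = λ a (c , e) → a · c , λ i → trans (cong (a *_) (e i)) (sym (⋆-· B a c i))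
  }

parity-coset : ∀ (B : Mat 24) {w k : Vec 24} → InSpan B (+ 2 · w) →
  Σ ℤ (λ a → InSpan B (k ⊖ a · w)) → InSpan B k ⊎ InSpan B (k ⊖ w)
parity-coset B {w} {k} 2w∈B (a , k-aw∈B) =
  by-residue (a %ℕ 2) (n%ℕd<d a 2) (reduce (a %ℕ 2) (a /ℕ 2) (a≡a%ℕn+[a/ℕn]*n a 2))
  where
  open LinearlyClosed (InSpan-linearlyClosed B)
  reduce : ∀ r q → a ≡ + r + q * + 2 → InSpan B (k ⊖ + r · w)
  reduce r q a≡r+2q =
    ≈-closed (λ i → trans (cong (λ t → k i - t * w i + q * (+ 2 * w i)) a≡r+2q)
                          (cancel (k i) (w i) (+ r) q))
             (⊕-closed k-aw∈B (·-closed q 2w∈B))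
    where
    cancel : ∀ k w r q → k - (r + q * + 2) * w + q * (+ 2 * w) ≡ k - r * w
    cancel = solve-∀
  by-residue : ∀ r → r ℕ.< 2 → InSpan B (k ⊖ + r · w) → InSpan B k ⊎ InSpan B (k ⊖ w)
  by-residue 0 _ k∈B = inj₁ (≈-closed (λ i → minus-0 (k i) (w i)) k∈B)
    where
    minus-0 : ∀ k w → k - + 0 * w ≡ k
    minus-0 = solve-∀
  by-residue 1 _ k-w∈B = inj₂ (≈-closed (λ i → cong (k i -_) (ℤP.*-identityˡ (w i))) k-w∈B)
  by-residue (ℕ.suc (ℕ.suc _)) (s≤s (s≤s ()))

IsGenerator : (w x y z : Vec 24) → Vec 24 → Set
IsGenerator w x y z g = g ≡ w ⊎ g ≡ x ⊎ g ≡ y ⊎ g ≡ z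

module _ {w x y z : Vec 24} where

  InK-elim : ∀ {P : Vec 24 → Set} → LinearlyClosed P →
    (∀ {g} → IsGenerator w x y z g → P g) → ∀ {k} → InK w x y z k → P k
  InK-elim P-closed P-gen (a , b , c , d , k≈) =
    ≈-closed (λ i → sym (k≈ i))
      (⊕-closed (⊕-closed (⊕-closed (·-closed a (P-gen (inj₁ refl)))
                                    (·-closed b (P-gen (inj₂ (inj₁ refl)))))
                          (·-closed c (P-gen (inj₂ (inj₂ (inj₁ refl))))))
                (·-closed d (P-gen (inj₂ (inj₂ (inj₂ refl))))))
    where open LinearlyClosed P-closed

  InK-linearlyClosed : LinearlyClosed (InK w x y z)
  InK-linearlyClosed = record
    { ≈-closed = λ u≈v (a , b , c , d , e) → a , b , c , d , λ i → trans (sym (u≈v i)) (e i)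
    ; ⊕-closed = λ (a , b , c , d , e) (a′ , b′ , c′ , d′ , e′) →
        a + a′ , b + b′ , c + c′ , d + d′ , λ i →
          trans (cong₂ _+_ (e i) (e′ i)) (add a b c d a′ b′ c′ d′ (w i) (x i) (y i) (z i))
    ; ·-closed = λ t (a , b , c , d , e) → t * a , t * b , t * c , t * d , λ i →
          trans (cong (t *_) (e i)) (scale t a b c d (w i) (x i) (y i) (z i))
    }
    where
    add : ∀ a b c d a′ b′ c′ d′ W X Y Z →
      (a * W + b * X + c * Y + d * Z) + (a′ * W + b′ * X + c′ * Y + d′ * Z) ≡
      (a + a′) * W + (b + b′) * X + (c + c′) * Y + (d + d′) * Z
    add = solve-∀
    scale : ∀ t a b c d W X Y Z → t * (a * W + b * X + c * Y + d * Z) ≡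
      t * a * W + t * b * X + t * c * Y + t * d * Z
    scale = solve-∀

  IsGenerator⇒InK : ∀ {g} → IsGenerator w x y z g → InK w x y z g
  IsGenerator⇒InK (inj₁ refl) =
    + 1 , + 0 , + 0 , + 0 , λ i → unit₁ (w i) (x i) (y i) (z i)
    where
    unit₁ : ∀ W X Y Z → W ≡ + 1 * W + + 0 * X + + 0 * Y + + 0 * Z
    unit₁ = solve-∀
  IsGenerator⇒InK (inj₂ (inj₁ refl)) =
    + 0 , + 1 , + 0 , + 0 , λ i → unit₂ (w i) (x i) (y i) (z i)
    where
    unit₂ : ∀ W X Y Z → X ≡ + 0 * W + + 1 * X + + 0 * Y + + 0 * Z
    unit₂ = solve-∀
  IsGenerator⇒InK (inj₂ (inj₂ (inj₁ refl))) =
    + 0 , + 0 , + 1 , + 0 , λ i → unit₃ (w i) (x i) (y i) (z i)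
    where
    unit₃ : ∀ W X Y Z → Y ≡ + 0 * W + + 0 * X + + 1 * Y + + 0 * Z
    unit₃ = solve-∀
  IsGenerator⇒InK (inj₂ (inj₂ (inj₂ refl))) =
    + 0 , + 0 , + 0 , + 1 , λ i → unit₄ (w i) (x i) (y i) (z i)
    where
    unit₄ : ∀ W X Y Z → Z ≡ + 0 * W + + 0 * X + + 0 * Y + + 1 * Z
    unit₄ = solve-∀

  InK-integral : ∀ {A : Mat 24} → IsSymmetric A →
    (∀ {g h} → IsGenerator w x y z g → IsGenerator w x y z h → Integral A g h) →
    ∀ {k k′} → InK w x y z k → InK w x y z k′ → Integral A k k′
  InK-integral {A} A-sym gen-integral {k} k∈K k′∈K =
    InK-elim {P = PairsIntegrallyWithK}
      (Π-linearlyClosed (λ u → Integral-linearlyClosed A (proj₁ u)))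
      (λ {g} g-gen (u , u∈K) → Integral-sym A-sym g u (generator-pairs-with-K g-gen u∈K))
      k′∈K (k , k∈K)
    where
    generator-pairs-with-K : ∀ {g} → IsGenerator w x y z g →
      ∀ {u} → InK w x y z u → Integral A g u
    generator-pairs-with-K {g} g-gen = InK-elim (Integral-linearlyClosed A g) (gen-integral g-gen)
    PairsIntegrallyWithK : Vec 24 → Set
    PairsIntegrallyWithK v = ∀ (u : Σ (Vec 24) (InK w x y z)) → Integral A (proj₁ u) v

  InK-evenNorm : ∀ {A : Mat 24} → IsSymmetric A →
    (∀ {g h} → IsGenerator w x y z g → IsGenerator w x y z h → Integral A g h) →
    (∀ {g} → IsGenerator w x y z g → EvenNorm A g) →
    ∀ {k} → InK w x y z k → EvenNorm A k
  InK-evenNorm A-sym gen-integral gen-even k∈K = proj₂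
    (InK-elim (EvenNorm-linearlyClosed A-sym InK-linearlyClosed (InK-integral A-sym gen-integral))
              (λ g-gen → IsGenerator⇒InK g-gen , gen-even g-gen) k∈K)

  InK-mod-span : ∀ (B : Mat 24) → InSpan B x → InSpan B y → InSpan B z →
    ∀ {k} → InK w x y z k → Σ ℤ λ a → InSpan B (k ⊖ a · w)
  InK-mod-span B x∈B y∈B z∈B (a , b , c , d , k≈) =
    a , ≈-closed (λ i → trans (drop-w a b c d (w i) (x i) (y i) (z i))
                              (cong (_- a * w i) (sym (k≈ i))))
                 (⊕-closed (⊕-closed (·-closed b x∈B) (·-closed c y∈B)) (·-closed d z∈B))
    where
    open LinearlyClosed (InSpan-linearlyClosed B)
    drop-w : ∀ a b c d W X Y Z →
      b * X + c * Y + d * Z ≡ (a * W + b * X + c * Y + d * Z) - a * W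
    drop-w = solve-∀

sublattice-norm : ∀ {n} {G B A : Mat n} →
  (∀ i j → (transpose B ⊗ (G ⊗ B)) i j ≡ + 2 * A i j) →
  ∀ {v} c → v ≈ (B ⋆ c) → form G v v ≡ + 2 * form A c c
sublattice-norm {G = G} {B} {A} gram {v} c v≈Bc =
  trans (form-cong G {v} {B ⋆ c} {v} {B ⋆ c} v≈Bc v≈Bc)
        (trans (form-⋆ G B c c) (form-scale (+ 2) gram c c))

SubIsLeech⇒evenNorm : ∀ {G B : Mat 24} → SubIsLeech G B → ∀ {v} → InSpan B v → EvenNorm G v
SubIsLeech⇒evenNorm {G} {B} (A , gram , leech) (c , v≈Bc) =
  subst (+ 4 ∣_) (sym (sublattice-norm {G = G} {B} {A} gram c v≈Bc))
    (*-monoʳ-∣ (+ 2) (form-even (IsLeechGram.symmetric leech) (IsLeechGram.even leech) c))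

SubIsLeech⇒norm≢4 : ∀ {G B : Mat 24} → SubIsLeech G B → ∀ {v} → InSpan B v → form G v v ≢ + 4
SubIsLeech⇒norm≢4 {G} {B} (A , gram , leech) (c , v≈Bc) norm≡4 = IsLeechGram.noRoots leech c
  (ℤP.*-cancelˡ-≡ (+ 2) (form A c c) (+ 2)
    (trans (sym (sublattice-norm {G = G} {B} {A} gram c v≈Bc)) norm≡4))

module _ {G BM BN : Mat 24} (isG : IsLeechGram G) (pol : IsPolarization G BM BN)
         (M≅Λ : SubIsLeech G BM) (N≅Λ : SubIsLeech G BN)
         {w x y z : Vec 24} (off : Offender G BM BN w x y z) where

  open IsPolarization pol
  open Admissible (Offender.admissible off)
  open LinearlyClosed (InSpan-linearlyClosed BM)

  private
    G-sym : IsSymmetric G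
    G-sym = IsLeechGram.symmetric isG

    M-evenNorm : ∀ {v} → InSpan BM v → EvenNorm G v
    M-evenNorm = SubIsLeech⇒evenNorm {G} {BM} M≅Λ

    N-evenNorm : ∀ {v} → InSpan BN v → EvenNorm G v
    N-evenNorm = SubIsLeech⇒evenNorm {G} {BN} N≅Λ

  xyz⊆M : ∀ {g} → g ≡ x ⊎ g ≡ y ⊎ g ≡ z → InSpan BM g
  xyz⊆M (inj₁ refl)        = x∈M
  xyz⊆M (inj₂ (inj₁ refl)) = y∈M
  xyz⊆M (inj₂ (inj₂ refl)) = z∈M

  xyz-w-integral : ∀ {g} → g ≡ x ⊎ g ≡ y ⊎ g ≡ z → Integral G g w
  xyz-w-integral {g} g∈xyz = even-norms⇒integral G-sym g w
    (M-evenNorm (xyz⊆M g∈xyz)) (N-evenNorm w∈N)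
    (∣-reflexive (sym (norm-with-w g∈xyz)))
    where
    norm-with-w : ∀ {g} → g ≡ x ⊎ g ≡ y ⊎ g ≡ z → NormΥ≡2 G (g ⊕ w)
    norm-with-w (inj₁ refl)        = Offender.xw off
    norm-with-w (inj₂ (inj₁ refl)) = Offender.yw off
    norm-with-w (inj₂ (inj₂ refl)) = Offender.zw off

  generators-integral : ∀ {g h} → IsGenerator w x y z g → IsGenerator w x y z h →
    Integral G g h
  generators-integral (inj₁ refl) (inj₁ refl) = N-integral w w w∈N w∈N
  generators-integral {h = h} (inj₁ refl) (inj₂ h∈xyz) =
    Integral-sym G-sym h w (xyz-w-integral h∈xyz)
  generators-integral (inj₂ g∈xyz) (inj₁ refl) = xyz-w-integral g∈xyz
  generators-integral {g} {h} (inj₂ g∈xyz) (inj₂ h∈xyz) =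
    M-integral g h (xyz⊆M g∈xyz) (xyz⊆M h∈xyz)

  generators-evenNorm : ∀ {g} → IsGenerator w x y z g → EvenNorm G g
  generators-evenNorm (inj₁ refl)   = N-evenNorm w∈N
  generators-evenNorm (inj₂ g∈xyz) = M-evenNorm (xyz⊆M g∈xyz)

  w∉M : ¬ InSpan BM w
  w∉M w∈M = SubIsLeech⇒norm≢4 {G} {BM} M≅Λ (⊕-closed x∈M w∈M) (Offender.xw off)

  InK⊆M∪w+M : ∀ k → InK w x y z k → InSpan BM k ⊎ InSpan BM (k ⊖ w)
  InK⊆M∪w+M k k∈K =
    parity-coset BM {w} {k} (proj₁ (2Υ-to-cap w)) (InK-mod-span {w} {x} {y} {z} BM x∈M y∈M z∈M k∈K)

lemma4p3 : ∀ (G BM BN : Mat 24) → IsLeechGram G →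
    IsPolarization G BM BN → SubIsLeech G BM → SubIsLeech G BN →
    ∀ (w x y z : Vec 24) → Offender G BM BN w x y z →
    ImageOrder2 BM (InK w x y z) × EvenIntegral G (InK w x y z)
lemma4p3 G BM BN isG pol M≅Λ N≅Λ w x y z off =
    (w , IsGenerator⇒InK (inj₁ refl) , w∉M isG pol M≅Λ N≅Λ off , InK⊆M∪w+M isG pol M≅Λ N≅Λ off)
  , (λ k k′ → InK-integral G-sym (generators-integral isG pol M≅Λ N≅Λ off))
  , (λ k → InK-evenNorm G-sym (generators-integral isG pol M≅Λ N≅Λ off)
                              (generators-evenNorm isG pol M≅Λ N≅Λ off))
  where
  G-sym : IsSymmetric G
  G-sym = IsLeechGram.symmetric isG
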